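{- Let $r,s,k,n$ be positive integers with $k\le n$ and $r+s$ dividing $k$, and let $f:[n]\to\{ -r,s\}$. If there are $k$-blocks $S,T\subseteq[n]$ with $f(S)<0$ and $f(T)>0$, then there is a $k$-block $B\subseteq[n]$ with $f(B)=0$.
   Context: $[n]=\{1,\ldots,n\}$; for $Y\subseteq[n]$, $f(Y)=\sum_{y\in Y}f(y)$. A $k$-block is a set of $k$ consecutive integers. -}

module Defs where

open import Data.Nat using (ℕ; zero; suc; _≤_; _+_)
open import Data.Integer using (ℤ; +_; -_)
open import Data.Integer as ℤ using ()
open import Data.Sum using (_⊎_)
open import Relation.Binary.PropositionalEquality using (_≡_)

TakesValues : (n r s : ℕ) → (ℕ → ℤ) → Set
TakesValues n r s f = ∀ i → 1 ≤ i → i ≤ n → (f i ≡ - (+ r)) ⊎ (f i ≡ + s)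

-- blockSum f a k = f(a+1) + … + f(a+k), the sum of f over the k-block {a+1,…,a+k}
blockSum : (ℕ → ℤ) → ℕ → ℕ → ℤ
blockSum f a zero = + 0
blockSum f a (suc k) = blockSum f a k ℤ.+ f (a + suc k)

BlockIn : (n k a : ℕ) → Set
BlockIn n k a = a + k ≤ n

-- Put D = r + s and k = m D. A block containing c copies of s has sum c D − k r = (c − m r) D, so it
-- is a zero-sum block exactly when c = m r. Sliding a block one step to the right changes c by at
-- most one, so as the block slides from S to T the count c passes through every value between
-- c(S) < m r < c(T), in particular through m r.
module Submission where

open import Defs
open import Data.Nat using (ℕ; _≤_; _+_; NonZero)
open import Data.Nat.Divisibility using (_∣_)
open import Data.Integer using (ℤ; +_; _<_; _>_)
open import Data.Product using (Σ; _×_)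
open import Relation.Binary.PropositionalEquality using (_≡_)

open import Data.Nat using (zero; suc; _*_; _⊔_; s≤s; z≤n; _≟_)
  renaming (_<_ to _<ℕ_)
open import Data.Nat.Properties
  using ( ≤-refl; ≤-trans; ≤-antisym; ≤-total; ≤-pred; m≤m+n; m≤n+m; +-monoʳ-≤; m≤n⇒m≤1+n
        ; +-comm; +-monoˡ-≤; ≤∧≢⇒<; ≰⇒>; <⇒≤; +-identityʳ; +-suc; *-cancelʳ-<; m≤m⊔n; m≤n⊔m; ⊔-lub; +-distribʳ-⊔
        ; m≤n⇒∃[o]m+o≡n; module ≤-Reasoning)
open import Data.Nat.Divisibility using (divides)
open import Data.Nat.Tactic.RingSolver as ℕ-Solver using ()
open import Data.Integer as ℤ using (_⊖_; -_; 0ℤ; +≤+)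
open import Data.Integer.Properties using (pos-*; [+m]-[+n]≡m⊖n; ⊖-≥; ⊖-≤; neg-≤-pos; n⊖n≡0)
  renaming (<⇒≱ to <⇒≱ℤ)
open import Data.Integer.Tactic.RingSolver as ℤ-Solver using ()
open import Data.Product using (_,_; proj₁; proj₂)
open import Data.Sum using (_⊎_; inj₁; inj₂)
open import Function using (_∘_)
open import Relation.Nullary using (yes; no; contradiction)
open import Relation.Binary.PropositionalEquality
  using (_≢_; refl; sym; trans; cong; cong₂; subst; module ≡-Reasoning)

⊖<0⇒< : ∀ {m n} → m ⊖ n < 0ℤ → m <ℕ n
⊖<0⇒< m⊖n<0 = ≰⇒> (λ n≤m → <⇒≱ℤ m⊖n<0 (subst (0ℤ ℤ.≤_) (sym (⊖-≥ n≤m)) (+≤+ z≤n)))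

0<⊖⇒> : ∀ {m n} → 0ℤ < m ⊖ n → n <ℕ m
0<⊖⇒> 0<m⊖n = ≰⇒> (λ m≤n → <⇒≱ℤ 0<m⊖n (subst (ℤ._≤ 0ℤ) (sym (⊖-≤ m≤n)) neg-≤-pos))

window : (ℕ → ℕ) → ℕ → ℕ → ℕ
window g a zero = 0
window g a (suc k) = window g a k + g (a + suc k)

window-slide : ∀ g a k → window g (suc a) k + g (suc a) ≡ window g a k + g (suc a + k)
window-slide g a zero = cong (g ∘ suc) (sym (+-identityʳ a))
window-slide g a (suc k) = begin
  window g (suc a) k + x + y  ≡⟨ swap (window g (suc a) k) x y ⟩
  window g (suc a) k + y + x  ≡⟨ cong (_+ x) (window-slide g a k) ⟩
  window g a k + g (suc a + k) + x  ≡⟨ cong (λ i → window g a k + g i + x) (sym (+-suc a k)) ⟩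
  window g a k + g (a + suc k) + x  ∎
  where
  open ≡-Reasoning
  x = g (suc a + suc k)
  y = g (suc a)
  swap : ∀ u v w → u + v + w ≡ u + w + v
  swap = ℕ-Solver.solve-∀

Slow : (ℕ → ℕ) → Set
Slow P = ∀ i → P (suc i) ≤ suc (P i) × P i ≤ suc (P (suc i))

m+o≡n+p⇒m≤1+n : ∀ {m n o p} → m + o ≡ n + p → p ≤ 1 → m ≤ suc n
m+o≡n+p⇒m≤1+n {m} {n} {o} {p} eq p≤1 = begin
  m      ≤⟨ m≤m+n m o ⟩
  m + o  ≡⟨ eq ⟩
  n + p  ≤⟨ +-monoʳ-≤ n p≤1 ⟩
  n + 1  ≡⟨ +-comm n 1 ⟩
  suc n  ∎
  where open ≤-Reasoning

window-slow : ∀ {g} → (∀ i → g i ≤ 1) → ∀ k → Slow (λ a → window g a k)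
window-slow {g} g≤1 k a =
  m+o≡n+p⇒m≤1+n (window-slide g a k) (g≤1 (suc a + k)) ,
  m+o≡n+p⇒m≤1+n (sym (window-slide g a k)) (g≤1 (suc a))

Between : ℕ → ℕ → ℕ → Set
Between x t y = (x ≤ t × t ≤ y) ⊎ (y ≤ t × t ≤ x)

between-self : ∀ {x t} → Between x t x → x ≡ t
between-self (inj₁ (x≤t , t≤x)) = ≤-antisym x≤t t≤x
between-self (inj₂ (x≤t , t≤x)) = ≤-antisym x≤t t≤x

module _ {P : ℕ → ℕ} (slow : Slow P) {t : ℕ} where

  between-step : ∀ {a y} → P a ≢ t → Between (P a) t y → Between (P (suc a)) t y
  between-step {a} Pa≢t (inj₁ (Pa≤t , t≤y)) =
    inj₁ (≤-trans (proj₁ (slow a)) (≤∧≢⇒< Pa≤t Pa≢t) , t≤y)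
  between-step {a} Pa≢t (inj₂ (y≤t , t≤Pa)) =
    inj₂ (y≤t , ≤-pred (≤-trans (≤∧≢⇒< t≤Pa (Pa≢t ∘ sym)) (proj₂ (slow a))))

  slow-walk : ∀ d a → Between (P a) t (P (a + d)) → Σ ℕ λ c → c ≤ a + d × P c ≡ t
  slow-walk zero a btw =
    a , m≤m+n a 0 , between-self (subst (Between (P a) t ∘ P) (+-identityʳ a) btw)
  slow-walk (suc d) a btw with P a ≟ t
  ... | yes Pa≡t = a , m≤m+n a (suc d) , Pa≡t
  ... | no Pa≢t
    with slow-walk d (suc a) (subst (Between (P (suc a)) t ∘ P) (+-suc a d) (between-step Pa≢t btw))
  ...   | c , c≤ , Pc≡t = c , subst (c ≤_) (sym (+-suc a d)) c≤ , Pc≡t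

  slow-ivt : ∀ {a b} → P a ≤ t → t ≤ P b → Σ ℕ λ c → c ≤ a ⊔ b × P c ≡ t
  slow-ivt {a} {b} Pa≤t t≤Pb with ≤-total a b
  ... | inj₁ a≤b with m≤n⇒∃[o]m+o≡n a≤b
  ...   | d , refl with slow-walk d a (inj₁ (Pa≤t , t≤Pb))
  ...     | c , c≤ , Pc≡t = c , ≤-trans c≤ (m≤n⊔m a (a + d)) , Pc≡t
  slow-ivt {a} {b} Pa≤t t≤Pb | inj₂ b≤a with m≤n⇒∃[o]m+o≡n b≤a
  ...   | d , refl with slow-walk d b (inj₂ (Pa≤t , t≤Pb))
  ...     | c , c≤ , Pc≡t = c , ≤-trans c≤ (m≤m⊔n (b + d) b) , Pc≡t

top : ℕ → ℤ → ℕ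
top s z with z ℤ.≟ + s
... | yes _ = 1
... | no _ = 0

top≤1 : ∀ s z → top s z ≤ 1
top≤1 s z with z ℤ.≟ + s
... | yes _ = s≤s z≤n
... | no _ = z≤n

top-affine : ∀ {r s} z → z ≡ - + r ⊎ z ≡ + s → z ≡ + top s z ℤ.* + (r + s) ℤ.- + r
top-affine {r} {s} z z-values with z ℤ.≟ + s | z-values
... | yes refl | _ = sym (at-top (+ r) (+ s))
  where
  at-top : ∀ u v → + 1 ℤ.* (u ℤ.+ v) ℤ.- u ≡ v
  at-top = ℤ-Solver.solve-∀
... | no _ | inj₁ refl = sym (at-bottom (+ r) (+ s))
  where
  at-bottom : ∀ u v → + 0 ℤ.* (u ℤ.+ v) ℤ.- u ≡ - u
  at-bottom = ℤ-Solver.solve-∀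
... | no z≢s | inj₂ z≡s = contradiction z≡s z≢s

blockSum-cong : ∀ {f g} a k → (∀ j → 1 ≤ j → j ≤ k → f (a + j) ≡ g (a + j)) →
                blockSum f a k ≡ blockSum g a k
blockSum-cong a zero f≡g = refl
blockSum-cong a (suc k) f≡g =
  cong₂ ℤ._+_ (blockSum-cong a k (λ j 1≤j j≤k → f≡g j 1≤j (m≤n⇒m≤1+n j≤k))) (f≡g (suc k) (s≤s z≤n) ≤-refl)

blockSum-affine : ∀ (g : ℕ → ℕ) (c d : ℤ) a k →
                  blockSum (λ i → + g i ℤ.* c ℤ.- d) a k ≡ + window g a k ℤ.* c ℤ.- + k ℤ.* d
blockSum-affine g c d a zero = refl
blockSum-affine g c d a (suc k) =
  trans (cong (ℤ._+ (+ g (a + suc k) ℤ.* c ℤ.- d)) (blockSum-affine g c d a k))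
        (regroup (+ window g a k) (+ g (a + suc k)) (+ k) c d)
  where
  regroup : ∀ w x j c d → (w ℤ.* c ℤ.- j ℤ.* d) ℤ.+ (x ℤ.* c ℤ.- d) ≡ (w ℤ.+ x) ℤ.* c ℤ.- (+ 1 ℤ.+ j) ℤ.* d
  regroup = ℤ-Solver.solve-∀

blockSum-two-valued : ∀ {n r s f} → TakesValues n r s f → ∀ a k → a + k ≤ n →
                      blockSum f a k ≡ (window (top s ∘ f) a k * (r + s)) ⊖ (k * r)
blockSum-two-valued {n} {r} {s} {f} f-values a k a+k≤n = begin
  blockSum f a k
    ≡⟨ blockSum-cong a k (λ j 1≤j j≤k → top-affine (f (a + j))
         (f-values (a + j) (≤-trans 1≤j (m≤n+m j a)) (≤-trans (+-monoʳ-≤ a j≤k) a+k≤n))) ⟩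
  blockSum (λ i → + top s (f i) ℤ.* + (r + s) ℤ.- + r) a k
    ≡⟨ blockSum-affine (top s ∘ f) (+ (r + s)) (+ r) a k ⟩
  + window (top s ∘ f) a k ℤ.* + (r + s) ℤ.- + k ℤ.* + r
    ≡⟨ cong₂ ℤ._-_ (sym (pos-* (window (top s ∘ f) a k) (r + s))) (sym (pos-* k r)) ⟩
  + (window (top s ∘ f) a k * (r + s)) ℤ.- + (k * r)
    ≡⟨ [+m]-[+n]≡m⊖n (window (top s ∘ f) a k * (r + s)) (k * r) ⟩
  (window (top s ∘ f) a k * (r + s)) ⊖ (k * r)  ∎
  where open ≡-Reasoning

blockSum-balanced : ∀ {n r s f} → TakesValues n r s f → ∀ m a → BlockIn n (m * (r + s)) a →
                    blockSum f a (m * (r + s)) ≡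
                    (window (top s ∘ f) a (m * (r + s)) * (r + s)) ⊖ (m * r * (r + s))
blockSum-balanced {r = r} {s} {f} f-values m a a-in =
  trans (blockSum-two-valued f-values a (m * (r + s)) a-in)
        (cong (window (top s ∘ f) a (m * (r + s)) * (r + s) ⊖_) (reorder m (r + s) r))
  where
  reorder : ∀ x y z → x * y * z ≡ x * z * y
  reorder = ℕ-Solver.solve-∀

lemma2p8 : (r s k n : ℕ) → .{{NonZero r}} → .{{NonZero s}} → .{{NonZero k}} → .{{NonZero n}} →
    k ≤ n → (r + s) ∣ k → (f : ℕ → ℤ) → TakesValues n r s f →
    (Σ ℕ λ a → BlockIn n k a × blockSum f a k < + 0) →
    (Σ ℕ λ b → BlockIn n k b × blockSum f b k > + 0) →
    Σ ℕ λ c → BlockIn n k c × blockSum f c k ≡ + 0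
lemma2p8 r s k n _ (divides m refl) f f-values (a , a-in , sum<0) (b , b-in , sum>0) =
  c , c-in , (begin
    blockSum f c k               ≡⟨ blockSum-balanced f-values m c c-in ⟩
    (count c * D) ⊖ (m * r * D)  ≡⟨ cong (λ x → (x * D) ⊖ (m * r * D)) count≡target ⟩
    (m * r * D) ⊖ (m * r * D)    ≡⟨ n⊖n≡0 (m * r * D) ⟩
    + 0                          ∎)
  where
  open ≡-Reasoning
  D = r + s
  count : ℕ → ℕ
  count i = window (top s ∘ f) i k
  count<target : count a <ℕ m * r
  count<target = *-cancelʳ-< D _ _ (⊖<0⇒< (subst (_< + 0) (blockSum-balanced f-values m a a-in) sum<0))
  target<count : m * r <ℕ count b
  target<count = *-cancelʳ-< D _ _ (0<⊖⇒> (subst (+ 0 <_) (blockSum-balanced f-values m b b-in) sum>0))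
  crossing : Σ ℕ λ c → c ≤ a ⊔ b × count c ≡ m * r
  crossing = slow-ivt (window-slow (top≤1 s ∘ f) k) (<⇒≤ count<target) (<⇒≤ target<count)
  c = proj₁ crossing
  count≡target : count c ≡ m * r
  count≡target = proj₂ (proj₂ crossing)
  c-in : BlockIn n k c
  c-in = ≤-trans (+-monoˡ-≤ k (proj₁ (proj₂ crossing)))
                 (subst (_≤ n) (sym (+-distribʳ-⊔ k a b)) (⊔-lub a-in b-in))
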